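{- Let $A$ be an $n\times m$ binary matrix that has no two identical rows, and suppose $A$ has a base $u_1,\dots,u_d$ (with respect to the binary rank) that is disjoint in rows. Then $\{u_1,\dots,u_d\}$ spans every other base of $A$.
   Context: A binary matrix has entries in $\{0,1\}$. A set $X$ of binary vectors spans a set $Y$ if every vector of $Y$ is the ordinary sum of some subset of $X$. A base of $A$ is a set of vectors in $\{0,1\}^n$ spanning all columns of $A$ of minimum cardinality among such spanning sets (its size equals the binary rank of $A$, the minimal $k$ with $A=UV$, $U,V$ binary $n\times k$ and $k\times m$ matrices). A base is disjoint in rows if no two of its vectors have a $1$ in the same coordinate. -}

module Defs where

open import Data.Nat using (ℕ; zero; suc; _+_; _≤_)
open import Data.Bool using (Bool; true; false; if_then_else_)
open import Data.Fin using (Fin)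
open import Data.Product using (Σ; ∃; _×_)
open import Relation.Binary.PropositionalEquality using (_≡_; _≢_)
open import Relation.Nullary using (¬_)
open import Function.Definitions using (Injective)

-- binary vectors in {0,1}^n, and n×m binary matrices (A i c = entry in row i, column c)
BVec : ℕ → Set
BVec n = Fin n → Bool

BMat : ℕ → ℕ → Set
BMat n m = Fin n → Fin m → Bool

bit : Bool → ℕ
bit true  = 1
bit false = 0

sumFin : (k : ℕ) → (Fin k → ℕ) → ℕ
sumFin zero    f = 0
sumFin (suc k) f = f Fin.zero + sumFin k (λ j → f (Fin.suc j))

col : ∀ {n m} → BMat n m → Fin m → BVec n
col A c i = A i c

-- a finite family X of k vectors (a set when injective); a subset is S : Fin k → Bool.
-- ordinary (integer) sum of the chosen vectors, coordinatewise
subsetSum : ∀ {n k} → (Fin k → BVec n) → (Fin k → Bool) → Fin n → ℕ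
subsetSum {k = k} X S i = sumFin k (λ j → if S j then bit (X j i) else 0)

SpansVec : ∀ {n k} → (Fin k → BVec n) → BVec n → Set
SpansVec {n} {k} X v = Σ (Fin k → Bool) (λ S → ∀ (i : Fin n) → subsetSum X S i ≡ bit (v i))

SpansCols : ∀ {n m k} → (Fin k → BVec n) → BMat n m → Set
SpansCols {m = m} X A = ∀ (c : Fin m) → SpansVec X (col A c)

IsBase : ∀ {n m k} → BMat n m → (Fin k → BVec n) → Set
IsBase {n} {m} {k} A X =
  Injective _≡_ _≡_ X × SpansCols X A ×
  (∀ (k' : ℕ) (Y : Fin k' → BVec n) → Injective _≡_ _≡_ Y → SpansCols Y A → k ≤ k')

DisjointInRows : ∀ {n k} → (Fin k → BVec n) → Set
DisjointInRows {n} {k} X =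
  ∀ (j j' : Fin k) → j ≢ j' → ∀ (i : Fin n) → ¬ (X j i ≡ true × X j' i ≡ true)

DistinctRows : ∀ {n m} → BMat n m → Set
DistinctRows {n} {m} A = ∀ (i i' : Fin n) → (∀ (c : Fin m) → A i c ≡ A i' c) → i ≡ i'

-- Spanning all columns of A, a row-disjoint family U reads off each row i covered by u_t as
-- the t-th selection bit, so any two rows covered by u_t agree in every column; as A has
-- distinct rows, every u_t is supported on at most one row. Such a family spans every
-- vector that vanishes on the rows it does not cover. A row covered by no u_t is a zero
-- row of A, and a vector of a base W with a 1 in a zero row is never selected, so W
-- without it would still span A, contradicting minimality. Hence U spans every vector of W.
module Submission where

open import Defs
open import Data.Nat using (ℕ; zero; suc; _+_)
open import Data.Nat.Properties using (+-identityʳ; +-commutativeSemigroup; 1+n≰n)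
open import Algebra.Properties.CommutativeSemigroup +-commutativeSemigroup using (x∙yz≈y∙xz)
open import Data.Fin using (Fin; punchIn)
open import Data.Fin.Properties using (punchInᵢ≢i; punchIn-injective; any?)
open import Data.Bool using (Bool; true; false; if_then_else_; _≟_)
open import Data.Bool.Properties using (¬-not; not-¬)
open import Data.Product using (_,_; proj₁; proj₂)
open import Function using (_∘_)
open import Relation.Binary.PropositionalEquality using (_≡_; _≢_; refl; sym; trans; cong; cong₂; subst; module ≡-Reasoning)
open import Relation.Nullary using (yes; no; does)
open import Relation.Nullary.Decidable using (_×-dec_)
open import Data.Empty using (⊥-elim)

sumFin-punchIn : ∀ k (f : Fin (suc k) → ℕ) (j : Fin (suc k)) →
  sumFin (suc k) f ≡ f j + sumFin k (f ∘ punchIn j)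
sumFin-punchIn k       f Fin.zero    = refl
sumFin-punchIn (suc k) f (Fin.suc j) = begin
  f Fin.zero + sumFin (suc k) (f ∘ Fin.suc)
    ≡⟨ cong (f Fin.zero +_) (sumFin-punchIn k (f ∘ Fin.suc) j) ⟩
  f Fin.zero + (f (Fin.suc j) + sumFin k (f ∘ Fin.suc ∘ punchIn j))
    ≡⟨ x∙yz≈y∙xz (f Fin.zero) (f (Fin.suc j)) _ ⟩
  f (Fin.suc j) + (f Fin.zero + sumFin k (f ∘ Fin.suc ∘ punchIn j))
    ∎
  where open ≡-Reasoning

sumFin-zero : ∀ k (f : Fin k → ℕ) → (∀ x → f x ≡ 0) → sumFin k f ≡ 0
sumFin-zero zero    f f≡0 = refl
sumFin-zero (suc k) f f≡0 rewrite f≡0 Fin.zero = sumFin-zero k (f ∘ Fin.suc) (f≡0 ∘ Fin.suc)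

bit-injective : ∀ {a b} → bit a ≡ bit b → a ≡ b
bit-injective {true}  {true}  _ = refl
bit-injective {false} {false} _ = refl

selected-true : ∀ (s : Bool) → (if s then bit true else 0) ≡ bit s
selected-true true  = refl
selected-true false = refl

selected-false : ∀ (s : Bool) → (if s then bit false else 0) ≡ 0
selected-false true  = refl
selected-false false = refl

module _ {n k : ℕ} (X : Fin (suc k) → BVec n) (S : Fin (suc k) → Bool) (i : Fin n) where

  subsetSum-punchIn : ∀ j →
    subsetSum X S i ≡ (if S j then bit (X j i) else 0) + subsetSum (X ∘ punchIn j) (S ∘ punchIn j) i
  subsetSum-punchIn = sumFin-punchIn k _

  subsetSum-unselected : ∀ j → S j ≡ false →
    subsetSum X S i ≡ subsetSum (X ∘ punchIn j) (S ∘ punchIn j) i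
  subsetSum-unselected j Sj≡false rewrite subsetSum-punchIn j | Sj≡false = refl

  subsetSum-selected-≢0 : ∀ j → S j ≡ true → X j i ≡ true → subsetSum X S i ≢ 0
  subsetSum-selected-≢0 j Sj≡true Xji≡true sum≡0
    rewrite subsetSum-punchIn j | Sj≡true | Xji≡true with sum≡0
  ... | ()

Uncovered : ∀ {n d} → (Fin d → BVec n) → Fin n → Set
Uncovered U i = ∀ t → U t i ≡ false

subsetSum-uncovered : ∀ {n d} (U : Fin d → BVec n) {i} → Uncovered U i →
  ∀ S → subsetSum U S i ≡ 0
subsetSum-uncovered {d = d} U {i} uncovered S = sumFin-zero d _ λ t →
  subst (λ b → (if S t then bit b else 0) ≡ 0) (sym (uncovered t)) (selected-false (S t))

subsetSum-disjoint : ∀ {n d} (U : Fin d → BVec n) → DisjointInRows U →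
  ∀ {t i} → U t i ≡ true → ∀ S → subsetSum U S i ≡ bit (S t)
subsetSum-disjoint {d = suc d} U disjoint {t} {i} Uti≡true S = begin
  subsetSum U S i
    ≡⟨ subsetSum-punchIn U S i t ⟩
  (if S t then bit (U t i) else 0) + subsetSum (U ∘ punchIn t) (S ∘ punchIn t) i
    ≡⟨ cong₂ _+_ (trans (cong (λ b → if S t then bit b else 0) Uti≡true) (selected-true (S t)))
                 (subsetSum-uncovered (U ∘ punchIn t) others-vanish (S ∘ punchIn t)) ⟩
  bit (S t) + 0
    ≡⟨ +-identityʳ _ ⟩
  bit (S t)
    ∎
  where
  open ≡-Reasoning
  others-vanish : Uncovered (U ∘ punchIn t) i
  others-vanish x with U (punchIn t x) i in eq
  ... | false = refl
  ... | true  = ⊥-elim (disjoint (punchIn t x) t (punchInᵢ≢i t x) i (eq , Uti≡true))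

SubsingletonSupports : ∀ {n d} → (Fin d → BVec n) → Set
SubsingletonSupports {n} {d} U = ∀ (t : Fin d) (i i' : Fin n) → U t i ≡ true → U t i' ≡ true → i ≡ i'

disjoint-spanning⇒subsingletonSupports : ∀ {n m d} (A : BMat n m) (U : Fin d → BVec n) →
  DistinctRows A → SpansCols U A → DisjointInRows U → SubsingletonSupports U
disjoint-spanning⇒subsingletonSupports A U distinct spans disjoint t i i' Uti≡true Uti'≡true =
  distinct i i' λ c →
    let (S , S-spans) = spans c in
    bit-injective (begin
      bit (A i c)      ≡⟨ sym (S-spans i) ⟩
      subsetSum U S i  ≡⟨ subsetSum-disjoint U disjoint Uti≡true S ⟩
      bit (S t)        ≡⟨ sym (subsetSum-disjoint U disjoint Uti'≡true S) ⟩
      subsetSum U S i' ≡⟨ S-spans i' ⟩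
      bit (A i' c)     ∎)
  where open ≡-Reasoning

spansVec-of-vanishing-off-cover : ∀ {n d} (U : Fin d → BVec n) →
  DisjointInRows U → SubsingletonSupports U →
  ∀ (v : BVec n) → (∀ i → Uncovered U i → v i ≡ false) → SpansVec U v
spansVec-of-vanishing-off-cover {d = d} U disjoint supports v vanishes = S , S-spans
  where
  S : Fin d → Bool
  S t = does (any? λ i → (U t i ≟ true) ×-dec (v i ≟ true))

  S-reads-v : ∀ {t i} → U t i ≡ true → S t ≡ v i
  S-reads-v {t} {i} Uti≡true with any? (λ i → (U t i ≟ true) ×-dec (v i ≟ true)) | v i in vi≡
  ... | yes _                      | true  = refl
  ... | no _                       | false = refl
  ... | no ¬witness                | true  = ⊥-elim (¬witness (i , Uti≡true , vi≡))
  ... | yes (i' , Uti'≡true , vi'≡true) | false =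
    ⊥-elim (not-¬ vi≡ (subst (λ x → v x ≡ true) (sym (supports t i i' Uti≡true Uti'≡true)) vi'≡true))

  S-spans : ∀ i → subsetSum U S i ≡ bit (v i)
  S-spans i with any? (λ t → U t i ≟ true)
  ... | yes (t , Uti≡true) = trans (subsetSum-disjoint U disjoint Uti≡true S) (cong bit (S-reads-v Uti≡true))
  ... | no ¬covered        = trans (subsetSum-uncovered U uncovered S) (cong bit (sym (vanishes i uncovered)))
    where
    uncovered : Uncovered U i
    uncovered t = ¬-not (¬covered ∘ (t ,_))

spansCols-uncovered⇒zeroRow : ∀ {n m d} (A : BMat n m) (U : Fin d → BVec n) → SpansCols U A →
  ∀ {i} → Uncovered U i → ∀ c → A i c ≡ false
spansCols-uncovered⇒zeroRow A U spans {i} uncovered c =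
  bit-injective (trans (sym (proj₂ (spans c) i)) (subsetSum-uncovered U uncovered (proj₁ (spans c))))

base-vanishes-on-zeroRow : ∀ {n m k} (A : BMat n m) (W : Fin k → BVec n) → IsBase A W →
  ∀ {i} → (∀ c → A i c ≡ false) → ∀ j → W j i ≡ false
base-vanishes-on-zeroRow {k = suc k} A W (injective , spans , minimal) {i} zeroRow j with W j i in Wji≡true
... | false = refl
... | true  = ⊥-elim (1+n≰n (minimal k (W ∘ punchIn j) injective-without-j spans-without-j))
  where
  j-unselected : ∀ c → proj₁ (spans c) j ≡ false
  j-unselected c = ¬-not λ Sj≡true →
    subsetSum-selected-≢0 W (proj₁ (spans c)) i j Sj≡true Wji≡true
      (trans (proj₂ (spans c) i) (cong bit (zeroRow c)))

  injective-without-j : ∀ {x y} → W (punchIn j x) ≡ W (punchIn j y) → x ≡ y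
  injective-without-j eq = punchIn-injective j _ _ (injective eq)

  spans-without-j : SpansCols (W ∘ punchIn j) A
  spans-without-j c = proj₁ (spans c) ∘ punchIn j , λ i' →
    trans (sym (subsetSum-unselected W (proj₁ (spans c)) i' j (j-unselected c))) (proj₂ (spans c) i')

mainTheorem16 : ∀ (n m d : ℕ) (A : BMat n m) (U : Fin d → BVec n) →
    DistinctRows A → IsBase A U → DisjointInRows U →
    ∀ (k : ℕ) (W : Fin k → BVec n) → IsBase A W →
    ∀ (j : Fin k) → SpansVec U (W j)
mainTheorem16 n m d A U distinct (_ , U-spans , _) disjoint k W W-base j =
  spansVec-of-vanishing-off-cover U disjoint
    (disjoint-spanning⇒subsingletonSupports A U distinct U-spans disjoint)
    (W j)
    λ i uncovered → base-vanishes-on-zeroRow A W W-base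
                      (spansCols-uncovered⇒zeroRow A U U-spans uncovered) j
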